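{- Let $G=(V,E)$ be a $(q+1,q)$-graph with $q\ge1$. The following are equivalent: (i) $G$ admits a $1$-super graceful labeling whose edge-label set is $[1,q]$; (ii) $G$ is graceful; (iii) $G$ admits a $1$-super graceful labeling in which all vertices receive odd labels.
   Context: All graphs are simple, finite, undirected and without isolated vertices; a $(p,q)$-graph has $p$ vertices and $q$ edges. For integers $a\le b$, $[a,b]$ is the set of integers between $a$ and $b$ inclusive. For $k\ge 1$, a $k$-super graceful labeling of a $(p,q)$-graph $G=(V,E)$ is a bijection $f:V\cup E\to[k,k+p+q-1]$ with $f(uv)=|f(u)-f(v)|$ for every edge $uv$. A graceful labeling of $G$ is an injective map $g:V\to[0,q]$ such that the induced edge labels $|g(u)-g(v)|$, $uv\in E$, are pairwise distinct; $G$ is graceful if it has one. -}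

module Defs where

open import Data.Nat using (ℕ; zero; suc; _+_; _*_; _∸_; _≤_; ∣_-_∣)
open import Data.Fin using (Fin)
open import Data.Product using (Σ; ∃; _×_; _,_; proj₁; proj₂)
open import Data.Sum using (_⊎_; inj₁; inj₂)
open import Relation.Binary.PropositionalEquality using (_≡_; _≢_)
open import Function.Definitions using (Injective)

SameEdge : {p : ℕ} → Fin p × Fin p → Fin p × Fin p → Set
SameEdge (a , b) (c , d) = (a ≡ c × b ≡ d) ⊎ (a ≡ d × b ≡ c)

record Graph (p q : ℕ) : Set where
  field
    ends       : Fin q → Fin p × Fin p
    loopless   : ∀ e → proj₁ (ends e) ≢ proj₂ (ends e)
    simple     : ∀ e e′ → SameEdge (ends e) (ends e′) → e ≡ e′
    noIsolated : ∀ v → ∃ λ e → (v ≡ proj₁ (ends e)) ⊎ (v ≡ proj₂ (ends e))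

open Graph public

Labeling : ℕ → ℕ → Set
Labeling p q = Fin p ⊎ Fin q → ℕ

IsSuperGraceful : {p q : ℕ} → ℕ → Graph p q → Labeling p q → Set
IsSuperGraceful {p} {q} k G f =
  Injective _≡_ _≡_ f
  × (∀ x → k ≤ f x × f x ≤ k + p + q ∸ 1)
  × (∀ n → k ≤ n → n ≤ k + p + q ∸ 1 → ∃ λ x → f x ≡ n)
  × (∀ e → f (inj₂ e) ≡ ∣ f (inj₁ (proj₁ (ends G e))) - f (inj₁ (proj₂ (ends G e))) ∣)

EdgeLabelSetIs : {p q : ℕ} → Labeling p q → ℕ → ℕ → Set
EdgeLabelSetIs {p} {q} f a b =
  (∀ e → a ≤ f (inj₂ e) × f (inj₂ e) ≤ b)
  × (∀ n → a ≤ n → n ≤ b → ∃ λ e → f (inj₂ e) ≡ n)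

Odd : ℕ → Set
Odd n = ∃ λ k → n ≡ suc (2 * k)

IsGraceful : {p q : ℕ} → Graph p q → (Fin p → ℕ) → Set
IsGraceful {p} {q} G g =
  Injective _≡_ _≡_ g
  × (∀ v → g v ≤ q)
  × Injective _≡_ _≡_ (λ e → ∣ g (proj₁ (ends G e)) - g (proj₂ (ends G e)) ∣)

Graceful : {p q : ℕ} → Graph p q → Set
Graceful {p} G = ∃ λ (g : Fin p → ℕ) → IsGraceful G g

module Submission where

-- Every labeling that occurs is AFFINE in a vertex map g: vertices get
-- a + b·g(v) and edges get b·|g(u) - g(w)|, with (a,b) = (q+1,1) for (i)
-- and (a,b) = (1,2) for (iii).  So each equivalence reduces to two facts:
--   * affine labelings always satisfy the edge condition of a super
--     graceful labeling, and conversely an injective labeling whose vertex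
--     part is affine in g makes g injective with distinct edge labels;
--   * a counting argument: an injective map from an n-element set into an
--     interval of n integers is onto, so the surjectivity parts of
--     "super graceful" and "edge labels are [1,q]" come for free.

open import Defs
open import Data.Nat using (ℕ; suc; _≤_)
open import Data.Fin using (Fin)
open import Data.Product using (∃; _×_)
open import Data.Sum using (inj₁)
open import Function.Bundles using (_⇔_)

open import Data.Nat using (zero; _+_; _*_; _∸_; _<_; ∣_-_∣; z≤n; s≤s; _≤?_; NonZero)
open import Data.Nat.Properties
open import Data.Fin using (fromℕ<; punchOut; splitAt; join)
open import Data.Fin.Properties
  using (fromℕ<-injective; punchOut-injective; injective⇒≤; any?; join-splitAt)
open import Data.Product using (_,_; proj₁; proj₂)
open import Data.Sum using (inj₂; [_,_])
open import Data.Sum.Properties using (inj₁-injective; inj₂-injective)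
open import Relation.Nullary using (yes; no; contradiction)
open import Relation.Binary.PropositionalEquality
  using (_≡_; _≢_; refl; sym; trans; cong; cong₂; subst; module ≡-Reasoning)
open import Function.Bundles using (mk⇔)
open import Function.Definitions using (Injective)

-- An injective map from an n-element set into [0, n) hits every value:
-- a missed value m would let the map be squeezed injectively into Fin (n-1).
injective-below⇒onto : ∀ {n} (h : Fin n → ℕ) → Injective _≡_ _≡_ h → (∀ x → h x < n) →
                       ∀ m → m < n → ∃ λ x → h x ≡ m
injective-below⇒onto {zero} h h-inj h<n m ()
injective-below⇒onto {suc k} h h-inj h<n m m<n with any? (λ x → h x ≟ m)
... | yes hit = hit
... | no miss = contradiction (injective⇒≤ squeeze-injective) (n≮n k)
  where
  avoids : ∀ x → fromℕ< m<n ≢ fromℕ< (h<n x)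
  avoids x eq = miss (x , sym (fromℕ<-injective m (h x) m<n (h<n x) eq))

  squeeze : Fin (suc k) → Fin k
  squeeze x = punchOut (avoids x)

  squeeze-injective : Injective _≡_ _≡_ squeeze
  squeeze-injective {x} {y} eq =
    h-inj (fromℕ<-injective (h x) (h y) (h<n x) (h<n y) (punchOut-injective (avoids x) (avoids y) eq))

-- The same statement for an arbitrary interval [k, k+n), by shifting down by k.
injective-interval⇒onto : ∀ {n} k (h : Fin n → ℕ) → Injective _≡_ _≡_ h →
                          (∀ x → k ≤ h x × h x < k + n) →
                          ∀ m → k ≤ m → m < k + n → ∃ λ x → h x ≡ m
injective-interval⇒onto {n} k h h-inj range m k≤m m<k+n =
  let x , hx∸k≡m∸k = injective-below⇒onto (λ x → h x ∸ k) shifted-injective shifted-below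
                                           (m ∸ k) (below m k≤m m<k+n)
  in x , ∸-cancelʳ-≡ (proj₁ (range x)) k≤m hx∸k≡m∸k
  where
  below : ∀ t → k ≤ t → t < k + n → t ∸ k < n
  below t k≤t t<k+n = subst (t ∸ k <_) (m+n∸m≡n k n) (∸-monoˡ-< t<k+n k≤t)

  shifted-injective : Injective _≡_ _≡_ (λ x → h x ∸ k)
  shifted-injective {x} {y} eq = h-inj (∸-cancelʳ-≡ (proj₁ (range x)) (proj₁ (range y)) eq)

  shifted-below : ∀ x → h x ∸ k < n
  shifted-below x = below (h x) (proj₁ (range x)) (proj₂ (range x))

affine-injective : ∀ {A : Set} a b .{{_ : NonZero b}} (g : A → ℕ) →
                   Injective _≡_ _≡_ g → Injective _≡_ _≡_ (λ x → a + b * g x)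
affine-injective a b g g-inj eq = g-inj (*-cancelˡ-≡ _ _ b (+-cancelˡ-≡ a _ _ eq))

[,]-injective : ∀ {A B : Set} (s : A → ℕ) (t : B → ℕ) →
                Injective _≡_ _≡_ s → Injective _≡_ _≡_ t → (∀ x y → s x ≢ t y) →
                Injective _≡_ _≡_ [ s , t ]
[,]-injective s t s-inj t-inj disjoint {inj₁ x} {inj₁ y} eq = cong inj₁ (s-inj eq)
[,]-injective s t s-inj t-inj disjoint {inj₁ x} {inj₂ y} eq = contradiction eq (disjoint x y)
[,]-injective s t s-inj t-inj disjoint {inj₂ x} {inj₁ y} eq = contradiction (sym eq) (disjoint y x)
[,]-injective s t s-inj t-inj disjoint {inj₂ x} {inj₂ y} eq = cong inj₂ (t-inj eq)

affine-distance : ∀ a b x y → ∣ a + b * x - a + b * y ∣ ≡ b * ∣ x - y ∣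
affine-distance a b x y = trans (∣m+n-m+o∣≡∣n-o∣ a (b * x) (b * y)) (sym (*-distribˡ-∣-∣ b x y))

double : ∀ n → 2 * n ≡ n + n
double n = cong (n +_) (+-identityʳ n)

module Labelings {p q : ℕ} (G : Graph p q) where

  tail head : Fin q → Fin p
  tail e = proj₁ (ends G e)
  head e = proj₂ (ends G e)

  edgeLabel : (Fin p → ℕ) → Fin q → ℕ
  edgeLabel g e = ∣ g (tail e) - g (head e) ∣

  EdgeCondition : Labeling p q → Set
  EdgeCondition f = ∀ e → f (inj₂ e) ≡ ∣ f (inj₁ (tail e)) - f (inj₁ (head e)) ∣

  affineLabeling : ℕ → ℕ → (Fin p → ℕ) → Labeling p q
  affineLabeling a b g = [ (λ v → a + b * g v) , (λ e → b * edgeLabel g e) ]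

  affine-edgeCondition : ∀ a b g → EdgeCondition (affineLabeling a b g)
  affine-edgeCondition a b g e = sym (affine-distance a b (g (tail e)) (g (head e)))

  -- Conversely, if an injective labeling with the edge condition has
  -- vertex labels a + b·g(v), then g is injective and its edge labels are
  -- distinct (they are the edge labels of f divided by b).
  affine-reflects-graceful : ∀ a b (f : Labeling p q) (g : Fin p → ℕ) →
    Injective _≡_ _≡_ f → EdgeCondition f → (∀ v → f (inj₁ v) ≡ a + b * g v) →
    Injective _≡_ _≡_ g × Injective _≡_ _≡_ (edgeLabel g)
  affine-reflects-graceful a b f g f-inj edge affine = g-injective , edgeLabel-injective
    where
    open ≡-Reasoning

    g-injective : Injective _≡_ _≡_ g
    g-injective {x} {y} gx≡gy = inj₁-injective (f-inj (begin
      f (inj₁ x)     ≡⟨ affine x ⟩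
      a + b * g x    ≡⟨ cong (λ t → a + b * t) gx≡gy ⟩
      a + b * g y    ≡⟨ sym (affine y) ⟩
      f (inj₁ y)     ∎))

    scaled : ∀ e → f (inj₂ e) ≡ b * edgeLabel g e
    scaled e = begin
      f (inj₂ e)                                           ≡⟨ edge e ⟩
      ∣ f (inj₁ (tail e)) - f (inj₁ (head e)) ∣            ≡⟨ cong₂ ∣_-_∣ (affine (tail e)) (affine (head e)) ⟩
      ∣ a + b * g (tail e) - a + b * g (head e) ∣          ≡⟨ affine-distance a b _ _ ⟩
      b * edgeLabel g e                                    ∎

    edgeLabel-injective : Injective _≡_ _≡_ (edgeLabel g)
    edgeLabel-injective {e} {e′} eq =
      inj₂-injective (f-inj (trans (scaled e) (trans (cong (b *_) eq) (sym (scaled e′)))))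

  -- The edge labels of a graceful labeling lie in [1,q]: 0 is excluded
  -- because G has no loops and g is injective.
  graceful-edgeLabel-range : ∀ g → IsGraceful G g → ∀ e → 1 ≤ edgeLabel g e × edgeLabel g e ≤ q
  graceful-edgeLabel-range g (g-inj , g≤q , _) e =
    n≢0⇒n>0 (λ label≡0 → loopless G e (g-inj (∣m-n∣≡0⇒m≡n label≡0)))
    , ≤-trans (∣m-n∣≤m⊔n (g (tail e)) (g (head e))) (⊔-lub (g≤q (tail e)) (g≤q (head e)))

  -- By counting, an injective labeling into [k, k+p+q-1] with the edge
  -- condition is automatically onto, hence k-super graceful (k = 1+j).
  superGraceful-by-counting : ∀ j (f : Labeling p q) → Injective _≡_ _≡_ f →
    (∀ x → suc j ≤ f x × f x ≤ j + p + q) → EdgeCondition f → IsSuperGraceful (suc j) G f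
  superGraceful-by-counting j f f-inj range edge = f-inj , range , onto , edge
    where
    within : ∀ t → t ≤ j + p + q → t < suc j + (p + q)
    within t t≤ = s≤s (≤-trans t≤ (≤-reflexive (+-assoc j p q)))

    flat : Fin (p + q) → ℕ
    flat i = f (splitAt p i)

    flat-injective : Injective _≡_ _≡_ flat
    flat-injective {i} {i′} eq =
      trans (sym (join-splitAt p q i)) (trans (cong (join p q) (f-inj eq)) (join-splitAt p q i′))

    onto : ∀ n → suc j ≤ n → n ≤ j + p + q → ∃ λ x → f x ≡ n
    onto n j<n n≤ with injective-interval⇒onto (suc j) flat flat-injective
                         (λ i → proj₁ (range (splitAt p i)) , within _ (proj₂ (range (splitAt p i))))
                         n j<n (within n n≤)
    ... | i , flat-i≡n = splitAt p i , flat-i≡n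

module OrderOneMoreThanSize (q : ℕ) (G : Graph (suc q) q) where
  open Labelings G

  EdgeLabelsInitial : Set
  EdgeLabelsInitial = ∃ λ (f : Labeling (suc q) q) → IsSuperGraceful 1 G f × EdgeLabelSetIs f 1 q

  OddVertexLabels : Set
  OddVertexLabels = ∃ λ (f : Labeling (suc q) q) → IsSuperGraceful 1 G f × (∀ v → Odd (f (inj₁ v)))

  -- (ii) ⇒ (i): put the vertices above the edges, v ↦ q + 1 + g(v).
  graceful⇒edgeLabelsInitial : Graceful G → EdgeLabelsInitial
  graceful⇒edgeLabelsInitial (g , graceful@(g-inj , g≤q , label-inj)) =
    f , superGraceful-by-counting 0 f f-inj range (affine-edgeCondition (suc q) 1 g) , edge-range , edge-onto
    where
    f : Labeling (suc q) q
    f = affineLabeling (suc q) 1 g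

    edge-range : ∀ e → 1 ≤ 1 * edgeLabel g e × 1 * edgeLabel g e ≤ q
    edge-range e rewrite *-identityˡ (edgeLabel g e) = graceful-edgeLabel-range g graceful e

    edge-injective : Injective _≡_ _≡_ (λ e → 1 * edgeLabel g e)
    edge-injective = affine-injective 0 1 (edgeLabel g) label-inj

    below-vertices : ∀ v e → suc q + 1 * g v ≢ 1 * edgeLabel g e
    below-vertices v e eq = <⇒≱ (s≤s (proj₂ (edge-range e))) (subst (suc q ≤_) eq (m≤m+n (suc q) _))

    f-inj : Injective _≡_ _≡_ f
    f-inj = [,]-injective _ _ (affine-injective (suc q) 1 g g-inj) edge-injective below-vertices

    range : ∀ x → 1 ≤ f x × f x ≤ suc q + q
    range (inj₁ v) = s≤s z≤n , +-monoʳ-≤ (suc q) (≤-trans (≤-reflexive (*-identityˡ (g v))) (g≤q v))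
    range (inj₂ e) = proj₁ (edge-range e) , ≤-trans (proj₂ (edge-range e)) (m≤n+m q (suc q))

    edge-onto : ∀ n → 1 ≤ n → n ≤ q → ∃ λ e → f (inj₂ e) ≡ n
    edge-onto n 1≤n n≤q = injective-interval⇒onto 1 _ edge-injective
                            (λ e → proj₁ (edge-range e) , s≤s (proj₂ (edge-range e))) n 1≤n (s≤s n≤q)

  -- (i) ⇒ (ii): the edges occupy [1,q], so every vertex label exceeds q,
  -- and g(v) = f(v) - (q + 1) is graceful.
  edgeLabelsInitial⇒graceful : EdgeLabelsInitial → Graceful G
  edgeLabelsInitial⇒graceful (f , (f-inj , range , _ , edge) , _ , edge-onto) =
    g , proj₁ reflected , g≤q , proj₂ reflected
    where
    above-edges : ∀ v → suc q ≤ f (inj₁ v)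
    above-edges v with f (inj₁ v) ≤? q
    ... | no fv≰q = ≰⇒> fv≰q
    ... | yes fv≤q with edge-onto (f (inj₁ v)) (proj₁ (range (inj₁ v))) fv≤q
    ...   | e , fe≡fv with f-inj fe≡fv
    ...     | ()

    g : Fin (suc q) → ℕ
    g v = f (inj₁ v) ∸ suc q

    affine : ∀ v → f (inj₁ v) ≡ suc q + 1 * g v
    affine v = trans (sym (m+[n∸m]≡n (above-edges v))) (cong (suc q +_) (sym (*-identityˡ (g v))))

    reflected : Injective _≡_ _≡_ g × Injective _≡_ _≡_ (edgeLabel g)
    reflected = affine-reflects-graceful (suc q) 1 f g f-inj edge affine

    g≤q : ∀ v → g v ≤ q
    g≤q v = subst (g v ≤_) (m+n∸m≡n (suc q) q) (∸-monoˡ-≤ (suc q) (proj₂ (range (inj₁ v))))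

  -- (ii) ⇒ (iii): v ↦ 2g(v) + 1 and e ↦ 2·(edge label), separated by parity.
  graceful⇒oddVertexLabels : Graceful G → OddVertexLabels
  graceful⇒oddVertexLabels (g , graceful@(g-inj , g≤q , label-inj)) =
    f , superGraceful-by-counting 0 f f-inj range (affine-edgeCondition 1 2 g) , (λ v → g v , refl)
    where
    f : Labeling (suc q) q
    f = affineLabeling 1 2 g

    f-inj : Injective _≡_ _≡_ f
    f-inj = [,]-injective _ _ (affine-injective 1 2 g g-inj) (affine-injective 0 2 (edgeLabel g) label-inj)
                          (λ v e eq → even≢odd (edgeLabel g e) (g v) (sym eq))

    doubled-≤ : ∀ {n} → n ≤ q → 2 * n ≤ q + q
    doubled-≤ {n} n≤q = subst (2 * n ≤_) (double q) (*-monoʳ-≤ 2 n≤q)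

    range : ∀ x → 1 ≤ f x × f x ≤ suc q + q
    range (inj₁ v) = s≤s z≤n , s≤s (doubled-≤ (g≤q v))
    range (inj₂ e) with graceful-edgeLabel-range g graceful e
    ... | 1≤label , label≤q = ≤-trans 1≤label (m≤m+n _ _) , m≤n⇒m≤1+n (doubled-≤ label≤q)

  oddVertexLabels⇒graceful : OddVertexLabels → Graceful G
  oddVertexLabels⇒graceful (f , (f-inj , range , _ , edge) , odd) =
    g , proj₁ reflected , g≤q , proj₂ reflected
    where
    g : Fin (suc q) → ℕ
    g v = proj₁ (odd v)

    reflected : Injective _≡_ _≡_ g × Injective _≡_ _≡_ (edgeLabel g)
    reflected = affine-reflects-graceful 1 2 f g f-inj edge (λ v → proj₂ (odd v))

    g≤q : ∀ v → g v ≤ q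
    g≤q v = *-cancelˡ-≤ 2 (subst (2 * g v ≤_) (sym (double q)) (≤-pred odd-bound))
      where
      odd-bound : suc (2 * g v) ≤ suc (q + q)
      odd-bound = subst (_≤ suc q + q) (proj₂ (odd v)) (proj₂ (range (inj₁ v)))

theorem2p9 : (q : ℕ) → 1 ≤ q → (G : Graph (suc q) q) →
    ((∃ λ (f : Labeling (suc q) q) → IsSuperGraceful 1 G f × EdgeLabelSetIs f 1 q)
      ⇔ Graceful G)
    × (Graceful G
      ⇔ (∃ λ (f : Labeling (suc q) q) → IsSuperGraceful 1 G f × (∀ v → Odd (f (inj₁ v)))))
theorem2p9 q _ G =
  mk⇔ edgeLabelsInitial⇒graceful graceful⇒edgeLabelsInitial
  , mk⇔ graceful⇒oddVertexLabels oddVertexLabels⇒graceful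
  where open OrderOneMoreThanSize q G
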